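{- Let $\Gamma\triangleright W$ be a CCCP configuration, $c$ a channel and $v$ a closed value. Then there is a system term $W'$ with $\Gamma\triangleright W\xrightarrow{c?v}W'$ such that: (1) if $\mathrm{rcv}(\Gamma\triangleright W,c)$ does not hold then $W'=W$; (2) if $\mathrm{rcv}(\Gamma\triangleright W,c)$ holds then $W'\neq W$ and $\Gamma\triangleright W\xrightarrow{c?w}W'$ for every closed value $w$.
   Context: The calculus CCCP. Fix a set of channels ranged over by $c,d$, and a set of values containing data variables $x,y$ and a distinguished error value $\mathtt{err}$; every closed value $v$ has a transmission time $\delta_v$, a positive integer. Expressions $e$ are built from values, with an evaluation map $[\![\cdot]\!]$ sending variable-free expressions to closed values; Boolean expressions $b$ are $e_1=e_2$ or $\mathrm{exp}(c)$. Processes: $P,Q ::= c!\langle e\rangle.P \mid \lfloor c?(x).P\rfloor Q \mid \sigma.P \mid \tau.P \mid P+Q \mid [b]P,Q \mid X \mid \mathbf{nil} \mid \mathrm{fix}\,X.P$. System terms: $W ::= P \mid \lceil c?(x).P\rceil \mid W_1\,|\,W_2 \mid \nu c{:}(n,v).W$ ($n\in\mathbb N$, $v$ closed). $x$ is bound in $P$ in both input forms, $X$ in $\mathrm{fix}\,X.P$, $c$ in $\nu c{:}(n,v).W$; terms are up to $\alpha$-conversion. In $\mathrm{fix}\,X.P$ every occurrence of $X$ in $P$ is guarded (inside a broadcast prefix, body or timeout branch of an input, a $\sigma$-prefix, or a matching branch). $\sigma^n.P$ denotes $n$ nested $\sigma$-prefixes. A channel environment $\Gamma$ maps channels to $\mathbb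 N\times\{\text{closed values}\}$; $\Gamma\vdash_t c:n$, $\Gamma\vdash_v c:w$ mean $\Gamma(c)=(n,w)$; $c$ is idle if $n=0$, exposed otherwise; $\Gamma[c\mapsto(n,v)]$ is the update at $c$. $c!v(\Gamma)$ agrees with $\Gamma$ except at $c$, where it is $(\delta_v,v)$ if $c$ idle in $\Gamma$ and $(\max(\delta_v,t_c),\mathtt{err})$ if exposed with $\Gamma\vdash_t c:t_c$. $[\![e_1=e_2]\!]_\Gamma$ true iff $[\![e_1]\!]=[\![e_2]\!]$; $[\![\mathrm{exp}(c)]\!]_\Gamma$ true iff $c$ exposed in $\Gamma$. Predicate $\mathrm{rcv}(W,c)$: true for $\lfloor c?(x).P\rfloor Q$; $\mathrm{rcv}(P+Q,c)=\mathrm{rcv}(P,c)\vee\mathrm{rcv}(Q,c)$; $\mathrm{rcv}(W_1|W_2,c)=\mathrm{rcv}(W_1,c)\vee\mathrm{rcv}(W_2,c)$; $\mathrm{rcv}(\mathrm{fix}\,X.P,c)=\mathrm{rcv}(P,c)$; $\mathrm{rcv}(\nu d{:}(n,v).W,c)=\mathrm{rcv}(W,c)$ for $d\ne c$; false otherwise (inputs on other channels, broadcasts, $\tau.P$, $\sigma.P$, matchings, $\mathbf{nil}$, variables, active receivers). $\mathrm{rcv}(\Gamma\triangleright W,c)$ iff $c$ idle in $\Gamma$ and $\mathrm{rcv}(W,c)$. A configuration $\Gamma\triangleright W$ has $W$ closed. Intensional transitions $\Gamma\triangleright W\xrightarrow{\lambda}W'$, $\lambda\in\{c!v,c?v,\sigma,\tau\}$,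 form the least relation closed under: (Snd) $[\![e]\!]=v$ gives $\Gamma\triangleright c!\langle e\rangle.P\xrightarrow{c!v}\sigma^{\delta_v}.P$; (Rcv) $c$ idle gives $\Gamma\triangleright\lfloor c?(x).P\rfloor Q\xrightarrow{c?v}\lceil c?(x).P\rceil$; (RcvIgn) not $\mathrm{rcv}(\Gamma\triangleright W,c)$ gives $\Gamma\triangleright W\xrightarrow{c?v}W$; (Sync) $W_1\xrightarrow{c!v}W_1'$, $W_2\xrightarrow{c?v}W_2'$ (under $\Gamma$) give $W_1|W_2\xrightarrow{c!v}W_1'|W_2'$, and symmetrically; (RcvPar) $W_i\xrightarrow{c?v}W_i'$ give $W_1|W_2\xrightarrow{c?v}W_1'|W_2'$; (TimeNil) $\mathbf{nil}\xrightarrow{\sigma}\mathbf{nil}$; (Sleep) $\sigma.P\xrightarrow{\sigma}P$; (ActRcv) $\Gamma\vdash_t c:n>1$ gives $\lceil c?(x).P\rceil\xrightarrow{\sigma}\lceil c?(x).P\rceil$; (EndRcv) $\Gamma\vdash_t c:1$, $\Gamma\vdash_v c:w$ give $\lceil c?(x).P\rceil\xrightarrow{\sigma}\{w/x\}P$; (Timeout) $c$ idle gives $\lfloor c?(x).P\rfloor Q\xrightarrow{\sigma}Q$; (RcvLate) $c$ exposed gives $\lfloor c?(x).P\rfloor Q\xrightarrow{\tau}\lceil c?(x).\{\mathtt{err}/x\}P\rceil$; (Tau) $\tau.P\xrightarrow{\tau}P$; (Then)/(Else) $[b]P,Q\xrightarrow{\tau}\sigma.P$ if $[\![b]\!]_\Gamma$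 true, $\xrightarrow{\tau}\sigma.Q$ if false; (TimePar) $W_i\xrightarrow{\sigma}W_i'$ give $W_1|W_2\xrightarrow{\sigma}W_1'|W_2'$; (TauPar) $W_1\xrightarrow{\tau}W_1'$ gives $W_1|W_2\xrightarrow{\tau}W_1'|W_2$, and symmetrically; (Rec) $\{\mathrm{fix}\,X.P/X\}P\xrightarrow{\lambda}W$ gives $\mathrm{fix}\,X.P\xrightarrow{\lambda}W$; (Sum) $P\xrightarrow{\lambda}W$, $\lambda\in\{\tau,c!v\}$ gives $P+Q\xrightarrow{\lambda}W$, and symmetrically; (SumTime) $P\xrightarrow{\sigma}P'$, $Q\xrightarrow{\sigma}Q'$ give $P+Q\xrightarrow{\sigma}P'+Q'$; (SumRcv) $P\xrightarrow{c?v}W$ and $\mathrm{rcv}(\Gamma\triangleright P,c)$ give $P+Q\xrightarrow{c?v}W$, and symmetrically; (ResI) $\Gamma[c\mapsto(n,v)]\triangleright W\xrightarrow{c!w}W'$ gives $\Gamma\triangleright\nu c{:}(n,v).W\xrightarrow{\tau}\nu c{:}(c!w(\Gamma[c\mapsto(n,v)])(c)).W'$; (ResV) $\Gamma[c\mapsto(n,v)]\triangleright W\xrightarrow{\lambda}W'$ with $c$ not in $\lambda$ gives $\Gamma\triangleright\nu c{:}(n,v).W\xrightarrow{\lambda}\nu c{:}(n,v).W'$. -}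

module Defs where

open import Data.Nat using (ℕ; zero; suc; _<_; _≤_; _⊔_; _<ᵇ_; _≡ᵇ_)
open import Data.Bool using (Bool; true; false; if_then_else_)
open import Data.List using (List; []; _∷_)
open import Data.Maybe using (Maybe; just; nothing)
open import Data.Product using (_×_; _,_; proj₁; proj₂)
open import Data.Sum using (_⊎_)
open import Data.Unit using (⊤)
open import Data.Empty using (⊥)
open import Relation.Nullary using (¬_)
open import Relation.Binary.PropositionalEquality using (_≡_; _≢_)

data CVal (K : Set) : Set where
  err : CVal K
  con : K → CVal K

-- Parameters of the calculus: constants, expression operators with
-- their evaluation, and transmission times (positive).
record Signature : Set₁ where
  field
    Const  : Set
    Op     : Set
    interp : Op → List (CVal Const) → CVal Const
    δ      : CVal Const → ℕ
    δ-pos  : (v : CVal Const) → 0 < δ v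

module CCCP (𝒮 : Signature) where
  open Signature 𝒮

  Value : Set
  Value = CVal Const

  -- Syntax (de Bruijn indices for data variables, process variables
  -- and restricted channels; syntactic equality = α-equivalence).

  Chan : Set
  Chan = ℕ

  data Val : Set where
    var : ℕ → Val
    cv  : Value → Val

  data Exp : Set where
    val : Val → Exp
    app : Op → List Exp → Exp

  data BExp : Set where
    _≐_  : Exp → Exp → BExp
    expo : Chan → BExp

  data Proc : Set where
    snd   : Chan → Exp → Proc → Proc
    inp   : Chan → Proc → Proc → Proc       -- ⌊c?(x).P⌋Q  (x bound in P)
    sig   : Proc → Proc
    tau   : Proc → Proc
    _⊕_   : Proc → Proc → Proc
    match : BExp → Proc → Proc → Proc
    pvar  : ℕ → Proc
    nil   : Proc
    fix   : Proc → Proc                     -- fix X.P (X bound in P)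

  data Sys : Set where
    proc : Proc → Sys
    act  : Chan → Proc → Sys                -- ⌈c?(x).P⌉ (x bound in P)
    _∥_  : Sys → Sys → Sys
    nu   : ℕ → Value → Sys → Sys            -- ν c:(n,v).W (c = index 0)

  sigN : ℕ → Proc → Proc
  sigN zero    P = P
  sigN (suc n) P = sig (sigN n P)

  -- Data-variable operations (f receives the current binder depth)

  mutual
    mapE : (ℕ → Val → Val) → ℕ → Exp → Exp
    mapE f d (val v)    = val (f d v)
    mapE f d (app o es) = app o (mapL f d es)

    mapL : (ℕ → Val → Val) → ℕ → List Exp → List Exp
    mapL f d []       = []
    mapL f d (e ∷ es) = mapE f d e ∷ mapL f d es

  mapB : (ℕ → Val → Val) → ℕ → BExp → BExp
  mapB f d (e₁ ≐ e₂) = mapE f d e₁ ≐ mapE f d e₂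
  mapB f d (expo c)  = expo c

  mapP : (ℕ → Val → Val) → ℕ → Proc → Proc
  mapP f d (snd c e P)   = snd c (mapE f d e) (mapP f d P)
  mapP f d (inp c P Q)   = inp c (mapP f (suc d) P) (mapP f d Q)
  mapP f d (sig P)       = sig (mapP f d P)
  mapP f d (tau P)       = tau (mapP f d P)
  mapP f d (P ⊕ Q)       = mapP f d P ⊕ mapP f d Q
  mapP f d (match b P Q) = match (mapB f d b) (mapP f d P) (mapP f d Q)
  mapP f d (pvar X)      = pvar X
  mapP f d nil           = nil
  mapP f d (fix P)       = fix (mapP f d P)

  predℕ : ℕ → ℕ
  predℕ zero    = zero
  predℕ (suc n) = n

  shiftV : ℕ → Val → Val
  shiftV d (var i) = if i <ᵇ d then var i else var (suc i)
  shiftV d (cv w)  = cv w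

  substV : Value → ℕ → Val → Val
  substV w d (var i) =
    if i ≡ᵇ d then cv w else (if i <ᵇ d then var i else var (predℕ i))
  substV w d (cv u)  = cv u

  instV : Value → ℕ → Val → Val
  instV w d (var i) = if i ≡ᵇ d then cv w else var i
  instV w d (cv u)  = cv u

  substD : Value → Proc → Proc
  substD w = mapP (substV w) 0

  -- {w/x}P keeping the binder x (used for ⌈c?(x).{err/x}P⌉)
  instD : Value → Proc → Proc
  instD w = mapP (instV w) 0

  shiftD : Proc → Proc
  shiftD = mapP shiftV 0

  shiftX : ℕ → Proc → Proc
  shiftX d (snd c e P)   = snd c e (shiftX d P)
  shiftX d (inp c P Q)   = inp c (shiftX d P) (shiftX d Q)
  shiftX d (sig P)       = sig (shiftX d P)
  shiftX d (tau P)       = tau (shiftX d P)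
  shiftX d (P ⊕ Q)       = shiftX d P ⊕ shiftX d Q
  shiftX d (match b P Q) = match b (shiftX d P) (shiftX d Q)
  shiftX d (pvar i)      = if i <ᵇ d then pvar i else pvar (suc i)
  shiftX d nil           = nil
  shiftX d (fix P)       = fix (shiftX (suc d) P)

  substX : ℕ → Proc → Proc → Proc
  substX d t (snd c e P)   = snd c e (substX d t P)
  substX d t (inp c P Q)   = inp c (substX d (shiftD t) P) (substX d t Q)
  substX d t (sig P)       = sig (substX d t P)
  substX d t (tau P)       = tau (substX d t P)
  substX d t (P ⊕ Q)       = substX d t P ⊕ substX d t Q
  substX d t (match b P Q) = match b (substX d t P) (substX d t Q)
  substX d t (pvar i)      =
    if i ≡ᵇ d then t else (if i <ᵇ d then pvar i else pvar (predℕ i))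
  substX d t nil           = nil
  substX d t (fix P)       = fix (substX (suc d) (shiftX 0 t) P)

  unfold : Proc → Proc
  unfold P = substX 0 (fix P) P

  mutual
    DBE : ℕ → Exp → Set
    DBE d (val (var i)) = i < d
    DBE d (val (cv _))  = ⊤
    DBE d (app o es)    = DBL d es

    DBL : ℕ → List Exp → Set
    DBL d []       = ⊤
    DBL d (e ∷ es) = DBE d e × DBL d es

  DBB : ℕ → BExp → Set
  DBB d (e₁ ≐ e₂) = DBE d e₁ × DBE d e₂
  DBB d (expo c)  = ⊤

  DBP : ℕ → Proc → Set
  DBP d (snd c e P)   = DBE d e × DBP d P
  DBP d (inp c P Q)   = DBP (suc d) P × DBP d Q
  DBP d (sig P)       = DBP d P
  DBP d (tau P)       = DBP d P
  DBP d (P ⊕ Q)       = DBP d P × DBP d Q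
  DBP d (match b P Q) = DBB d b × DBP d P × DBP d Q
  DBP d (pvar X)      = ⊤
  DBP d nil           = ⊤
  DBP d (fix P)       = DBP d P

  XBP : ℕ → Proc → Set
  XBP d (snd c e P)   = XBP d P
  XBP d (inp c P Q)   = XBP d P × XBP d Q
  XBP d (sig P)       = XBP d P
  XBP d (tau P)       = XBP d P
  XBP d (P ⊕ Q)       = XBP d P × XBP d Q
  XBP d (match b P Q) = XBP d P × XBP d Q
  XBP d (pvar i)      = i < d
  XBP d nil           = ⊤
  XBP d (fix P)       = XBP (suc d) P

  ClosedP : Proc → Set
  ClosedP P = DBP 0 P × XBP 0 P

  ClosedS : Sys → Set
  ClosedS (proc P)   = ClosedP P
  ClosedS (act c P)  = DBP 1 P × XBP 0 P
  ClosedS (W₁ ∥ W₂)  = ClosedS W₁ × ClosedS W₂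
  ClosedS (nu n v W) = ClosedS W

  Guarded : ℕ → Proc → Set
  Guarded k (snd c e P)   = ⊤
  Guarded k (inp c P Q)   = ⊤
  Guarded k (sig P)       = ⊤
  Guarded k (tau P)       = Guarded k P
  Guarded k (P ⊕ Q)       = Guarded k P × Guarded k Q
  Guarded k (match b P Q) = ⊤
  Guarded k (pvar i)      = i ≢ k
  Guarded k nil           = ⊤
  Guarded k (fix P)       = Guarded (suc k) P

  WFP : Proc → Set
  WFP (snd c e P)   = WFP P
  WFP (inp c P Q)   = WFP P × WFP Q
  WFP (sig P)       = WFP P
  WFP (tau P)       = WFP P
  WFP (P ⊕ Q)       = WFP P × WFP Q
  WFP (match b P Q) = WFP P × WFP Q
  WFP (pvar i)      = ⊤
  WFP nil           = ⊤
  WFP (fix P)       = Guarded 0 P × WFP P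

  WFS : Sys → Set
  WFS (proc P)   = WFP P
  WFS (act c P)  = WFP P
  WFS (W₁ ∥ W₂)  = WFS W₁ × WFS W₂
  WFS (nu n v W) = WFS W

  Env : Set
  Env = Chan → ℕ × Value

  idle : Env → Chan → Set
  idle Γ c = proj₁ (Γ c) ≡ 0

  exposed : Env → Chan → Set
  exposed Γ c = ¬ idle Γ c

  extend : Env → ℕ × Value → Env
  extend Γ p zero    = p
  extend Γ p (suc c) = Γ c

  bcast : Value → ℕ × Value → ℕ × Value
  bcast v (zero , w)    = (δ v , v)
  bcast v (suc t , w)   = (δ v ⊔ suc t , err)

  mutual
    evalE : Exp → Maybe Value
    evalE (val (var _)) = nothing
    evalE (val (cv w))  = just w
    evalE (app o es)    with evalL es
    ... | just ws = just (interp o ws)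
    ... | nothing = nothing

    evalL : List Exp → Maybe (List Value)
    evalL [] = just []
    evalL (e ∷ es) with evalE e | evalL es
    ... | just w  | just ws = just (w ∷ ws)
    ... | _       | _       = nothing

  evalB : Env → BExp → Set
  evalB Γ (e₁ ≐ e₂) = evalE e₁ ≡ evalE e₂
  evalB Γ (expo c)  = exposed Γ c

  rcvP : Proc → Chan → Set
  rcvP (inp d P Q) c = d ≡ c
  rcvP (P ⊕ Q)     c = rcvP P c ⊎ rcvP Q c
  rcvP (fix P)     c = rcvP P c
  rcvP _           c = ⊥

  rcvS : Sys → Chan → Set
  rcvS (proc P)   c = rcvP P c
  rcvS (act d P)  c = ⊥
  rcvS (W₁ ∥ W₂)  c = rcvS W₁ c ⊎ rcvS W₂ c
  rcvS (nu n v W) c = rcvS W (suc c)   -- inner index suc c ≠ bound channel 0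

  rcv : Env → Sys → Chan → Set
  rcv Γ W c = idle Γ c × rcvS W c

  data Label : Set where
    out : Chan → Value → Label
    inL : Chan → Value → Label
    σ   : Label
    τ   : Label

  liftL : Label → Label
  liftL (out c v) = out (suc c) v
  liftL (inL c v) = inL (suc c) v
  liftL σ = σ
  liftL τ = τ

  data TauOrOut : Label → Set where
    isτ   : TauOrOut τ
    isOut : ∀ {c v} → TauOrOut (out c v)

  infix 4 _⊢_─[_]→_
  data _⊢_─[_]→_ (Γ : Env) : Sys → Label → Sys → Set where
    Snd : ∀ {c e P v} → evalE e ≡ just v →
          Γ ⊢ proc (snd c e P) ─[ out c v ]→ proc (sigN (δ v) P)
    Rcv : ∀ {c P Q v} → idle Γ c →
          Γ ⊢ proc (inp c P Q) ─[ inL c v ]→ act c P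
    RcvIgn : ∀ {W c v} → ¬ rcv Γ W c →
          Γ ⊢ W ─[ inL c v ]→ W
    SyncL : ∀ {W₁ W₂ W₁' W₂' c v} →
          Γ ⊢ W₁ ─[ out c v ]→ W₁' → Γ ⊢ W₂ ─[ inL c v ]→ W₂' →
          Γ ⊢ W₁ ∥ W₂ ─[ out c v ]→ W₁' ∥ W₂'
    SyncR : ∀ {W₁ W₂ W₁' W₂' c v} →
          Γ ⊢ W₁ ─[ inL c v ]→ W₁' → Γ ⊢ W₂ ─[ out c v ]→ W₂' →
          Γ ⊢ W₁ ∥ W₂ ─[ out c v ]→ W₁' ∥ W₂'
    RcvPar : ∀ {W₁ W₂ W₁' W₂' c v} →
          Γ ⊢ W₁ ─[ inL c v ]→ W₁' → Γ ⊢ W₂ ─[ inL c v ]→ W₂' →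
          Γ ⊢ W₁ ∥ W₂ ─[ inL c v ]→ W₁' ∥ W₂'
    TimeNil : Γ ⊢ proc nil ─[ σ ]→ proc nil
    Sleep : ∀ {P} → Γ ⊢ proc (sig P) ─[ σ ]→ proc P
    ActRcv : ∀ {c P} → 1 < proj₁ (Γ c) →
          Γ ⊢ act c P ─[ σ ]→ act c P
    EndRcv : ∀ {c P w} → Γ c ≡ (1 , w) →
          Γ ⊢ act c P ─[ σ ]→ proc (substD w P)
    Timeout : ∀ {c P Q} → idle Γ c →
          Γ ⊢ proc (inp c P Q) ─[ σ ]→ proc Q
    RcvLate : ∀ {c P Q} → exposed Γ c →
          Γ ⊢ proc (inp c P Q) ─[ τ ]→ act c (instD err P)
    Tau : ∀ {P} → Γ ⊢ proc (tau P) ─[ τ ]→ proc P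
    Then : ∀ {b P Q} → evalB Γ b →
          Γ ⊢ proc (match b P Q) ─[ τ ]→ proc (sig P)
    Else : ∀ {b P Q} → ¬ evalB Γ b →
          Γ ⊢ proc (match b P Q) ─[ τ ]→ proc (sig Q)
    TimePar : ∀ {W₁ W₂ W₁' W₂'} →
          Γ ⊢ W₁ ─[ σ ]→ W₁' → Γ ⊢ W₂ ─[ σ ]→ W₂' →
          Γ ⊢ W₁ ∥ W₂ ─[ σ ]→ W₁' ∥ W₂'
    TauParL : ∀ {W₁ W₂ W₁'} → Γ ⊢ W₁ ─[ τ ]→ W₁' →
          Γ ⊢ W₁ ∥ W₂ ─[ τ ]→ W₁' ∥ W₂
    TauParR : ∀ {W₁ W₂ W₂'} → Γ ⊢ W₂ ─[ τ ]→ W₂' →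
          Γ ⊢ W₁ ∥ W₂ ─[ τ ]→ W₁ ∥ W₂'
    Rec : ∀ {P l W} → Γ ⊢ proc (unfold P) ─[ l ]→ W →
          Γ ⊢ proc (fix P) ─[ l ]→ W
    SumL : ∀ {P Q l W} → TauOrOut l → Γ ⊢ proc P ─[ l ]→ W →
          Γ ⊢ proc (P ⊕ Q) ─[ l ]→ W
    SumR : ∀ {P Q l W} → TauOrOut l → Γ ⊢ proc Q ─[ l ]→ W →
          Γ ⊢ proc (P ⊕ Q) ─[ l ]→ W
    SumTime : ∀ {P Q P' Q'} →
          Γ ⊢ proc P ─[ σ ]→ proc P' → Γ ⊢ proc Q ─[ σ ]→ proc Q' →
          Γ ⊢ proc (P ⊕ Q) ─[ σ ]→ proc (P' ⊕ Q')
    SumRcvL : ∀ {P Q c v W} → Γ ⊢ proc P ─[ inL c v ]→ W →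
          rcv Γ (proc P) c →
          Γ ⊢ proc (P ⊕ Q) ─[ inL c v ]→ W
    SumRcvR : ∀ {P Q c v W} → Γ ⊢ proc Q ─[ inL c v ]→ W →
          rcv Γ (proc Q) c →
          Γ ⊢ proc (P ⊕ Q) ─[ inL c v ]→ W
    ResI : ∀ {n v W w W'} →
          extend Γ (n , v) ⊢ W ─[ out 0 w ]→ W' →
          Γ ⊢ nu n v W ─[ τ ]→
              nu (proj₁ (bcast w (n , v))) (proj₂ (bcast w (n , v))) W'
    ResV : ∀ {n v W l W'} →
          extend Γ (n , v) ⊢ W ─[ liftL l ]→ W' →
          Γ ⊢ nu n v W ─[ l ]→ nu n v W'

-- Every configuration Γ ▷ W can react to an input c?v, and it does so
-- uniformly in v: either W cannot receive on c and ignores the input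
-- (RcvIgn), or it can and moves to a different term W' that is the same
-- for every transmitted value (receivers become active receivers
-- ⌈c?(x).P⌉ and the received value only matters when reception ends).
--
-- The only delicate case is a receiver hidden under recursion: the rule
-- Rec passes from fix P to its unfolding {fix P/X}P, which is not a
-- structural subterm.  We therefore work with processes of the form
-- "P under a finite sequence of process-variable substitutions" and
-- recurse on P itself; since substitution does not touch the top-level
-- structure that rcv inspects (inputs, sums, fix), rcv is preserved.

module Submission where

open import Defs
open import Data.Nat using (ℕ; suc; _≟_)
open import Data.List using (List; []; _∷_)
open import Data.Product using (Σ; _×_; _,_; proj₁)
open import Data.Sum using (inj₁; inj₂)
open import Data.Empty using (⊥-elim)
open import Relation.Nullary using (¬_; Dec; yes; no; _×-dec_; _⊎-dec_)
open import Relation.Binary.PropositionalEquality using (_≡_; _≢_; refl)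

module Reception (𝒮 : Signature) where
  open CCCP 𝒮

  rcvP-substX : ∀ {c} d t P → rcvP P c → rcvP (substX d t P) c
  rcvP-substX d t (inp _ P Q) r        = r
  rcvP-substX d t (P ⊕ Q)     (inj₁ r) = inj₁ (rcvP-substX d t P r)
  rcvP-substX d t (P ⊕ Q)     (inj₂ r) = inj₂ (rcvP-substX d t Q r)
  rcvP-substX d t (fix P)     r        = rcvP-substX (suc d) (shiftX 0 t) P r

  -- A sequence of process-variable substitutions (depth, term), applied
  -- right to left; unfolding fix P extends the sequence by (0 , fix P).
  SubstSeq : Set
  SubstSeq = List (ℕ × Proc)

  applySeq : SubstSeq → Proc → Proc
  applySeq []             P = P
  applySeq ((d , t) ∷ ss) P = substX d t (applySeq ss P)

  underFix : SubstSeq → SubstSeq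
  underFix []             = []
  underFix ((d , t) ∷ ss) = (suc d , shiftX 0 t) ∷ underFix ss

  underInp : SubstSeq → SubstSeq
  underInp []             = []
  underInp ((d , t) ∷ ss) = (d , shiftD t) ∷ underInp ss

  applySeq-inp : ∀ ss c P Q →
    applySeq ss (inp c P Q) ≡ inp c (applySeq (underInp ss) P) (applySeq ss Q)
  applySeq-inp []             c P Q = refl
  applySeq-inp ((d , t) ∷ ss) c P Q rewrite applySeq-inp ss c P Q = refl

  applySeq-⊕ : ∀ ss P Q → applySeq ss (P ⊕ Q) ≡ applySeq ss P ⊕ applySeq ss Q
  applySeq-⊕ []             P Q = refl
  applySeq-⊕ ((d , t) ∷ ss) P Q rewrite applySeq-⊕ ss P Q = refl

  applySeq-fix : ∀ ss P → applySeq ss (fix P) ≡ fix (applySeq (underFix ss) P)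
  applySeq-fix []             P = refl
  applySeq-fix ((d , t) ∷ ss) P rewrite applySeq-fix ss P = refl

  rcvP-applySeq : ∀ {c} ss P → rcvP P c → rcvP (applySeq ss P) c
  rcvP-applySeq []             P r = r
  rcvP-applySeq ((d , t) ∷ ss) P r =
    rcvP-substX d t (applySeq ss P) (rcvP-applySeq ss P r)

  -- The recursion is
  -- on P, the substitution sequence absorbing the unfoldings of fix.
  receiveProc : ∀ {Γ c} → idle Γ c → ∀ ss P → rcvP P c →
    Σ Proc (λ P' → (w : Value) → Γ ⊢ proc (applySeq ss P) ─[ inL c w ]→ act c P')
  receiveProc {c = c} i ss (inp .c P Q) refl rewrite applySeq-inp ss c P Q =
    applySeq (underInp ss) P , λ w → Rcv i
  receiveProc i ss (P ⊕ Q) (inj₁ r) rewrite applySeq-⊕ ss P Q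
    with receiveProc i ss P r
  ... | P' , step = P' , λ w → SumRcvL (step w) (i , rcvP-applySeq ss P r)
  receiveProc i ss (P ⊕ Q) (inj₂ r) rewrite applySeq-⊕ ss P Q
    with receiveProc i ss Q r
  ... | Q' , step = Q' , λ w → SumRcvR (step w) (i , rcvP-applySeq ss Q r)
  receiveProc i ss (fix P) r rewrite applySeq-fix ss P
    with receiveProc i ((0 , fix (applySeq (underFix ss) P)) ∷ underFix ss) P r
  ... | P' , step = P' , λ w → Rec (step w)

  rcvP? : ∀ P c → Dec (rcvP P c)
  rcvP? (inp d P Q)   c = d ≟ c
  rcvP? (P ⊕ Q)       c = rcvP? P c ⊎-dec rcvP? Q c
  rcvP? (fix P)       c = rcvP? P c
  rcvP? (snd _ _ _)   c = no λ ()
  rcvP? (sig _)       c = no λ ()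
  rcvP? (tau _)       c = no λ ()
  rcvP? (match _ _ _) c = no λ ()
  rcvP? (pvar _)      c = no λ ()
  rcvP? nil           c = no λ ()

  Response : Env → Sys → Chan → Set
  Response Γ W c = Σ Sys λ W' → ((w : Value) → Γ ⊢ W ─[ inL c w ]→ W')
                              × (rcv Γ W c → W' ≢ W)
                              × (¬ rcv Γ W c → W' ≡ W)

  ignore : ∀ {Γ W c} → ¬ rcv Γ W c → Response Γ W c
  ignore {W = W} nr = W , (λ w → RcvIgn nr) , (λ r → ⊥-elim (nr r)) , (λ _ → refl)

  -- Under ν c:(n,v) the extended environment agrees with Γ on the shifted
  -- channel suc c, so rcv for ν W is definitionally rcv for W inside.
  respond : ∀ Γ W c → Response Γ W c
  respond Γ (proc P) c with (proj₁ (Γ c) ≟ 0) ×-dec rcvP? P c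
  ... | no nr = ignore nr
  ... | yes (i , r) with receiveProc i [] P r
  ...   | P' , step = act c P' , step , (λ _ ()) , (λ nr → ⊥-elim (nr (i , r)))
  respond Γ (act d P) c = ignore λ ()
  respond Γ (W₁ ∥ W₂) c with respond Γ W₁ c | respond Γ W₂ c
  ... | W₁' , step₁ , moves₁ , stays₁ | W₂' , step₂ , moves₂ , stays₂ =
    W₁' ∥ W₂' , (λ w → RcvPar (step₁ w) (step₂ w)) , moves , stays
    where
      moves : rcv Γ (W₁ ∥ W₂) c → W₁' ∥ W₂' ≢ W₁ ∥ W₂
      moves (i , inj₁ r) refl = moves₁ (i , r) refl
      moves (i , inj₂ r) refl = moves₂ (i , r) refl

      stays : ¬ rcv Γ (W₁ ∥ W₂) c → W₁' ∥ W₂' ≡ W₁ ∥ W₂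
      stays nr rewrite stays₁ (λ { (i , r) → nr (i , inj₁ r) })
                     | stays₂ (λ { (i , r) → nr (i , inj₂ r) }) = refl
  respond Γ (nu n v W) c with respond (extend Γ (n , v)) W (suc c)
  ... | W' , step , moves , stays =
    nu n v W' , (λ w → ResV (step w)) , moves' , stays'
    where
      moves' : rcv Γ (nu n v W) c → nu n v W' ≢ nu n v W
      moves' r refl = moves r refl

      stays' : ¬ rcv Γ (nu n v W) c → nu n v W' ≡ nu n v W
      stays' nr rewrite stays nr = refl

mainTheorem4 : (𝒮 : Signature) → let open CCCP 𝒮 in
    (Γ : Env) (W : Sys) → ClosedS W → WFS W → (c : Chan) (v : Value) →
    Σ Sys (λ W' → (Γ ⊢ W ─[ inL c v ]→ W')
                × (¬ rcv Γ W c → W' ≡ W)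
                × (rcv Γ W c → (W' ≢ W) × ((w : Value) → Γ ⊢ W ─[ inL c w ]→ W')))
mainTheorem4 𝒮 Γ W _ _ c v with Reception.respond 𝒮 Γ W c
... | W' , step , moves , stays = W' , step v , stays , λ r → moves r , step
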